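{- Let $\pi$ be a permutation of $[n]$, $T\ge1$, and for each round $t\in[T]$ let $m_t\ge1$ and $\rho_t:[n]\to\{0,1,\dots,m_t-1\}$. Define $\hat\rho_T=\rho_T$ and $\hat\rho_t=\rho_t+m_t\hat\rho_{t+1}$ for $1\le t\le T-1$. Then the $T$-round queue shuffle of $\pi$ with pile assignments $(\rho_1,\dots,\rho_T)$ yields the same permutation as the single-round queue shuffle of $\pi$ with pile assignments $\hat\rho_1$.
   Context: A deck of cards labelled by $[n]$ is represented by a permutation $\pi$ of $[n]$ with $\pi(s)$ the position (from the top) of label $s$. A single-round queue shuffle with pile assignments $\rho$ (label $s$ goes to pile $\rho(s)$, piles collected in increasing order of index, each pile preserving placement order) maps $\pi$ to the unique permutation $\sigma$ of $[n]$ with $\sigma(s)<\sigma(t)$ iff $(\rho(s),\pi(s))<(\rho(t),\pi(t))$ lexicographically. A $T$-round queue shuffle with pile assignments $(\rho_1,\dots,\rho_T)$ maps $\pi$ to $\pi_T$, where $\pi_0=\pi$ and $\pi_t$ is the single-round queue shuffle of $\pi_{t-1}$ with $\rho_t$. In round $t$ there are $m_t$ queues, indexed $0,\dots,m_t-1$. -}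

module Defs where

open import Data.Nat using (ℕ; zero; suc; _+_; _*_; _<_)
open import Data.Fin using (Fin; toℕ) renaming (zero to fzero; suc to fsuc)
open import Data.Fin.Permutation using (Permutation′; _⟨$⟩ʳ_)
open import Data.Product using (_×_)
open import Data.Sum using (_⊎_)
open import Relation.Binary.PropositionalEquality using (_≡_)
open import Function.Bundles using (_⇔_)

-- Deck of n cards: a permutation π of Fin n, π ⟨$⟩ʳ s = position (0-indexed) of label s.
Deck : ℕ → Set
Deck n = Permutation′ n

LexLt : ℕ → ℕ → ℕ → ℕ → Set
LexLt a i b j = (a < b) ⊎ ((a ≡ b) × (i < j))

IsQueueShuffle : {n : ℕ} → Deck n → (Fin n → ℕ) → Deck n → Set
IsQueueShuffle π ρ σ =
  ∀ s t → (toℕ (σ ⟨$⟩ʳ s) < toℕ (σ ⟨$⟩ʳ t))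
          ⇔ LexLt (ρ s) (toℕ (π ⟨$⟩ʳ s)) (ρ t) (toℕ (π ⟨$⟩ʳ t))

-- Combined assignment ρ̂₁ for rounds indexed 0..T-1 (round fzero = paper's round 1):
-- ρ̂_T = ρ_T,  ρ̂_t = ρ_t + m_t * ρ̂_{t+1}.
combined : {n : ℕ} (T : ℕ) → (Fin T → ℕ) → (Fin T → Fin n → ℕ) → Fin n → ℕ
combined zero          m ρ s = 0
combined (suc zero)    m ρ s = ρ fzero s
combined (suc (suc T)) m ρ s = ρ fzero s + m fzero * combined (suc T) (λ t → m (fsuc t)) (λ t → ρ (fsuc t)) s

{-# OPTIONS --safe #-}
-- A round with assignment ρ_t orders the labels by (ρ_t, position before the round). Going back
-- from the last round, the final order is therefore lexicographic in (ρ̂_{t+1}, ρ_t, position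
-- before round t), and because 0 ≤ ρ_t < m_t the mixed-radix number ρ_t + m_t ρ̂_{t+1} compares
-- exactly like the pair (ρ̂_{t+1}, ρ_t). So after T rounds the labels are in the order of the
-- one-round shuffle with ρ̂_1, and a permutation of [n] is determined by the relative order of
-- its values.
module Submission where

open import Defs
open import Data.Nat using (ℕ; _<_; _≤_; _+_; _*_; zero; suc; z≤n)
open import Data.Nat.Properties
open import Data.Fin as Fin using (Fin; toℕ; inject₁; fromℕ) renaming (zero to fzero; suc to fsuc)
open import Data.Fin.Properties using (toℕ-injective; toℕ-inject₁; ≤̄⇒inject₁<)
open import Data.Fin.Induction using (<-weakInduction)
open import Data.Fin.Permutation using (Permutation′; _⟨$⟩ʳ_; _⟨$⟩ˡ_; inverseˡ; inverseʳ)
open import Data.Product using (_×_; _,_)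
open import Data.Sum using (inj₁; inj₂)
open import Data.Empty using (⊥-elim)
open import Function.Base using (_∘_)
open import Function.Bundles using (_⇔_; mk⇔; Equivalence)
open import Function.Properties.Equivalence using () renaming (sym to ⇔-sym; trans to ⇔-trans)
open import Relation.Binary.Core using (_Preserves_⟶_)
open import Relation.Binary.Definitions using (tri<; tri≈; tri>)
open import Relation.Binary.PropositionalEquality

open Equivalence

+-*-<-carry : ∀ {m a b c d} → a < m → c < d → a + m * c < b + m * d
+-*-<-carry {m} {a} {b} {c} {d} a<m c<d = begin-strict
  a + m * c <⟨ +-monoˡ-< (m * c) a<m ⟩
  m + m * c ≡⟨ *-suc m c ⟨
  m * suc c ≤⟨ *-monoʳ-≤ m c<d ⟩
  m * d     ≤⟨ m≤n+m (m * d) b ⟩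
  b + m * d ∎
  where open ≤-Reasoning

+-*-<⇔LexLt : ∀ {m a b c d} → a < m → b < m → (a + m * c < b + m * d ⇔ LexLt c a d b)
+-*-<⇔LexLt {m} {a} {b} {c} {d} a<m b<m = mk⇔ to′ from′
  where
  to′ : a + m * c < b + m * d → LexLt c a d b
  to′ lt with <-cmp c d
  ... | tri< c<d _ _  = inj₁ c<d
  ... | tri≈ _ refl _ = inj₂ (refl , +-cancelʳ-< (m * c) a b lt)
  ... | tri> _ _ d<c  = ⊥-elim (<-asym lt (+-*-<-carry b<m d<c))
  from′ : LexLt c a d b → a + m * c < b + m * d
  from′ (inj₁ c<d)          = +-*-<-carry a<m c<d
  from′ (inj₂ (refl , a<b)) = +-monoˡ-< (m * c) a<b

+-*-injective : ∀ {m a b c d} → a < m → b < m → a + m * c ≡ b + m * d → c ≡ d × a ≡ b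
+-*-injective {m} {a} {b} {c} {d} a<m b<m eq with <-cmp c d
... | tri< c<d _ _  = ⊥-elim (<-irrefl eq (+-*-<-carry a<m c<d))
... | tri≈ _ refl _ = refl , +-cancelʳ-≡ (m * c) a b eq
... | tri> _ _ d<c  = ⊥-elim (<-irrefl (sym eq) (+-*-<-carry b<m d<c))

LexLt-+-*⇔ : ∀ {m a b c d x y p q} → a < m → b < m → (p < q ⇔ LexLt a x b y) →
             LexLt c p d q ⇔ LexLt (a + m * c) x (b + m * d) y
LexLt-+-*⇔ {m} {a} {b} {c} {d} {x} {y} {p} {q} a<m b<m p<q⇔ = mk⇔ to′ from′
  where
  to′ : LexLt c p d q → LexLt (a + m * c) x (b + m * d) y
  to′ (inj₁ c<d) = inj₁ (from (+-*-<⇔LexLt a<m b<m) (inj₁ c<d))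
  to′ (inj₂ (refl , p<q)) with to p<q⇔ p<q
  ... | inj₁ a<b          = inj₁ (+-monoˡ-< (m * c) a<b)
  ... | inj₂ (refl , x<y) = inj₂ (refl , x<y)
  from′ : LexLt (a + m * c) x (b + m * d) y → LexLt c p d q
  from′ (inj₁ lt) with to (+-*-<⇔LexLt a<m b<m) lt
  ... | inj₁ c<d         = inj₁ c<d
  ... | inj₂ (c≡d , a<b) = inj₂ (c≡d , from p<q⇔ (inj₁ a<b))
  from′ (inj₂ (eq , x<y)) with +-*-injective a<m b<m eq
  ... | c≡d , a≡b = inj₂ (c≡d , from p<q⇔ (inj₂ (a≡b , x<y)))

combined-IsQueueShuffle : ∀ {n} T (m : Fin T → ℕ) (ρ : Fin T → Fin n → ℕ) → (∀ t s → ρ t s < m t) →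
  (πs : Fin (suc T) → Deck n) →
  (∀ t → IsQueueShuffle (πs (inject₁ t)) (ρ t) (πs (fsuc t))) →
  IsQueueShuffle (πs fzero) (combined T m ρ) (πs (fromℕ T))
combined-IsQueueShuffle zero m ρ ρ<m πs rounds s t = mk⇔ (λ lt → inj₂ (refl , lt)) from′
  where
  from′ : LexLt 0 (toℕ (πs fzero ⟨$⟩ʳ s)) 0 (toℕ (πs fzero ⟨$⟩ʳ t)) →
          toℕ (πs fzero ⟨$⟩ʳ s) < toℕ (πs fzero ⟨$⟩ʳ t)
  from′ (inj₂ (_ , lt)) = lt
combined-IsQueueShuffle (suc zero) m ρ ρ<m πs rounds = rounds fzero
combined-IsQueueShuffle (suc (suc T)) m ρ ρ<m πs rounds s t =
  ⇔-trans (combined-IsQueueShuffle (suc T) (m ∘ fsuc) (ρ ∘ fsuc) (ρ<m ∘ fsuc) (πs ∘ fsuc) (rounds ∘ fsuc) s t)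
          (LexLt-+-*⇔ (ρ<m fzero s) (ρ<m fzero t) (rounds fzero s t))

strictlyMonotone⇒≤ : ∀ {n} (f : Fin n → Fin n) → f Preserves Fin._<_ ⟶ Fin._<_ → ∀ i → i Fin.≤ f i
strictlyMonotone⇒≤ {suc n} f f-mono = <-weakInduction (λ i → i Fin.≤ f i) z≤n step
  where
  step : ∀ i → inject₁ i Fin.≤ f (inject₁ i) → fsuc i Fin.≤ f (fsuc i)
  step i ih = begin-strict
    toℕ i                  ≡⟨ toℕ-inject₁ i ⟨
    toℕ (inject₁ i)        ≤⟨ ih ⟩
    toℕ (f (inject₁ i))    <⟨ f-mono (≤̄⇒inject₁< ≤-refl) ⟩
    toℕ (f (fsuc i))       ∎
    where open ≤-Reasoning

sameOrder⇒≤ : ∀ {n} (P Q : Permutation′ n) →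
  (∀ s t → P ⟨$⟩ʳ s Fin.< P ⟨$⟩ʳ t ⇔ Q ⟨$⟩ʳ s Fin.< Q ⟨$⟩ʳ t) →
  ∀ s → P ⟨$⟩ʳ s Fin.≤ Q ⟨$⟩ʳ s
sameOrder⇒≤ P Q sameOrder s =
  subst (λ u → P ⟨$⟩ʳ s Fin.≤ Q ⟨$⟩ʳ u) (inverseˡ P) ≤-after-P⁻¹
  where
  P⁻¹-then-Q-mono : (λ i → Q ⟨$⟩ʳ (P ⟨$⟩ˡ i)) Preserves Fin._<_ ⟶ Fin._<_
  P⁻¹-then-Q-mono {i} {j} i<j =
    to (sameOrder (P ⟨$⟩ˡ i) (P ⟨$⟩ˡ j)) (subst₂ Fin._<_ (sym (inverseʳ P)) (sym (inverseʳ P)) i<j)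
  ≤-after-P⁻¹ = strictlyMonotone⇒≤ _ P⁻¹-then-Q-mono (P ⟨$⟩ʳ s)

sameOrder⇒≗ : ∀ {n} (P Q : Permutation′ n) →
  (∀ s t → P ⟨$⟩ʳ s Fin.< P ⟨$⟩ʳ t ⇔ Q ⟨$⟩ʳ s Fin.< Q ⟨$⟩ʳ t) →
  ∀ s → P ⟨$⟩ʳ s ≡ Q ⟨$⟩ʳ s
sameOrder⇒≗ P Q sameOrder s = toℕ-injective (≤-antisym
  (sameOrder⇒≤ P Q sameOrder s)
  (sameOrder⇒≤ Q P (λ s t → ⇔-sym (sameOrder s t)) s))

IsQueueShuffle-resp-≗ : ∀ {n} {π π′ : Deck n} {ρ σ} → (∀ s → π ⟨$⟩ʳ s ≡ π′ ⟨$⟩ʳ s) →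
  IsQueueShuffle π ρ σ → IsQueueShuffle π′ ρ σ
IsQueueShuffle-resp-≗ {ρ = ρ} {σ = σ} π≗π′ shuffle s t =
  subst₂ (λ i j → toℕ (σ ⟨$⟩ʳ s) < toℕ (σ ⟨$⟩ʳ t) ⇔ LexLt (ρ s) (toℕ i) (ρ t) (toℕ j))
         (π≗π′ s) (π≗π′ t) (shuffle s t)

IsQueueShuffle-unique : ∀ {n} {π : Deck n} {ρ σ σ′} →
  IsQueueShuffle π ρ σ → IsQueueShuffle π ρ σ′ → ∀ s → σ ⟨$⟩ʳ s ≡ σ′ ⟨$⟩ʳ s
IsQueueShuffle-unique {σ = σ} {σ′} shuffle shuffle′ =
  sameOrder⇒≗ σ σ′ (λ s t → ⇔-trans (shuffle s t) (⇔-sym (shuffle′ s t)))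

lemma10 : (n T : ℕ) → 1 ≤ T → (m : Fin T → ℕ) → (∀ t → 1 ≤ m t)
    → (ρ : Fin T → Fin n → ℕ) → (∀ t s → ρ t s < m t)
    → (π : Deck n)
    → (πs : Fin (ℕ.suc T) → Deck n)
    → (∀ s → πs fzero ⟨$⟩ʳ s ≡ π ⟨$⟩ʳ s)
    → (∀ (t : Fin T) → IsQueueShuffle (πs (inject₁ t)) (ρ t) (πs (fsuc t)))
    → (σ : Deck n) → IsQueueShuffle π (combined T m ρ) σ
    → ∀ s → πs (fromℕ T) ⟨$⟩ʳ s ≡ σ ⟨$⟩ʳ s
lemma10 n T _ m _ ρ ρ<m π πs πs₀≗π rounds σ shuffle =
  IsQueueShuffle-unique {π = π} {ρ = ρ̂} {σ = πs (fromℕ T)} {σ′ = σ} combinedShuffle shuffle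
  where
  ρ̂ = combined T m ρ
  combinedShuffle : IsQueueShuffle π ρ̂ (πs (fromℕ T))
  combinedShuffle = IsQueueShuffle-resp-≗ {π = πs fzero} {π′ = π} {ρ = ρ̂} {σ = πs (fromℕ T)} πs₀≗π
    (combined-IsQueueShuffle T m ρ ρ<m πs rounds)
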